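{- Let $(\alpha_n)_{n\ge0}$ be a sequence of complex numbers and $A_n(x)=\sum_{\nu=0}^{n}\binom{n}{\nu}\alpha_{n-\nu}x^\nu$. For integers $r,s\ge0$ define the bivariate polynomials $A_{r,s}(x,y)=\sum_{\nu=0}^{r}\binom{r}{\nu}y^{r-\nu}A_{s+\nu}(x)$. Then for all $r,s\ge0$, $$A_{r,s}(x,y)=A_{s,r}(x+y,-y),$$ and if $A_m(1-x)=(-1)^mA_m(x)$ for all $m\ge0$, then $$(-1)^rA_{r,s}(x,y)=(-1)^sA_{s,r}(1-x-y,y).$$
   Context: $\alpha_0=0$ is allowed. -}

module Defs where

open import Level using (Level)
open import Data.Nat using (ℕ; zero; suc; _∸_)
open import Data.Nat.Combinatorics using (_C_)
open import Algebra.Bundles using (CommutativeRing)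

-- Operations over an arbitrary commutative ring R (ℂ is the paper's case).
module Ops {c ℓ : Level} (R : CommutativeRing c ℓ) where
  open CommutativeRing R

  fromℕ : ℕ → Carrier
  fromℕ zero    = 0#
  fromℕ (suc n) = 1# + fromℕ n

  pow : Carrier → ℕ → Carrier
  pow x zero    = 1#
  pow x (suc n) = x * pow x n

  sgn : ℕ → Carrier
  sgn m = pow (- 1#) m

  sumTo : ℕ → (ℕ → Carrier) → Carrier
  sumTo zero    f = f 0
  sumTo (suc n) f = sumTo n f + f (suc n)

  Apoly : (ℕ → Carrier) → ℕ → Carrier → Carrier
  Apoly α n x = sumTo n (λ ν → fromℕ (n C ν) * (α (n ∸ ν) * pow x ν))

  Abi : (ℕ → Carrier) → ℕ → ℕ → Carrier → Carrier → Carrier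
  Abi α r s x y = sumTo r (λ ν → fromℕ (r C ν) * (pow y (r ∸ ν) * Apoly α (s Data.Nat.+ ν) x))

-- Both A_n(x) and A_{r,s}(x,y) are binomial convolutions (p ⋆ q)(n) = Σ_ν C(n,ν) p(n−ν) q(ν),
-- and by Pascal's rule ⋆ satisfies the Leibniz rule (p ⋆ q)(n+1) = (p' ⋆ q)(n) + (p ⋆ q')(n)
-- for index shifts p', q'. Induction with it gives the Appell translation formula
-- A_n(x+y) = Σ_ν C(n,ν) y^{n−ν} A_ν(x), which is the case r = 0 of A_{r,s}(x,y) = A_{s,r}(x+y,−y),
-- and the recurrence A_{r+1,s} = y A_{r,s} + A_{r,s+1}. Applying the recurrence on both sides,
-- the y-terms cancel, which carries the identity from r to r+1.
-- For the reflection identity, A_{r+ν}(1−x−y) = (−1)^{r+ν} A_{r+ν}(x+y) turns A_{s,r}(1−x−y,y)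
-- into (−1)^{r+s} A_{s,r}(x+y,−y) = (−1)^{r+s} A_{r,s}(x,y).
module Submission where

open import Defs
open import Level using (Level)
open import Data.Nat as ℕ using (ℕ; zero; suc; _∸_; _≤_; z≤n)
import Data.Nat.Properties as ℕₚ
open import Data.Nat.Combinatorics using (_C_; nCk+nC[k+1]≡[n+1]C[k+1])
open import Data.Nat.Combinatorics.Specification using (k>n⇒nCk≡0)
open import Data.Product using (_×_; _,_)
open import Algebra.Bundles using (CommutativeRing)
import Relation.Binary.PropositionalEquality as ≡

module BinomialConvolution {c ℓ : Level} (R : CommutativeRing c ℓ) where
  open CommutativeRing R
  open Ops R
  open import Relation.Binary.Reasoning.Setoid setoid
  open import Algebra.Solver.Ring.NaturalCoefficients.Default commutativeSemiring
  open import Algebra.Properties.Ring ring using (-1*x≈-x)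
  open import Algebra.Properties.Group +-group using (⁻¹-involutive)
  open import Algebra.Properties.AbelianGroup +-abelianGroup using (⁻¹-∙-comm)

  fromℕ-homo-+ : ∀ m n → fromℕ (m ℕ.+ n) ≈ fromℕ m + fromℕ n
  fromℕ-homo-+ zero    n = sym (+-identityˡ (fromℕ n))
  fromℕ-homo-+ (suc m) n = trans (+-congˡ (fromℕ-homo-+ m n)) (sym (+-assoc 1# (fromℕ m) (fromℕ n)))

  pow-cong : ∀ n {x x′} → x ≈ x′ → pow x n ≈ pow x′ n
  pow-cong zero    x≈x′ = refl
  pow-cong (suc n) x≈x′ = *-cong x≈x′ (pow-cong n x≈x′)

  pow-homo-* : ∀ x m n → pow x (m ℕ.+ n) ≈ pow x m * pow x n
  pow-homo-* x zero    n = sym (*-identityˡ _)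
  pow-homo-* x (suc m) n = trans (*-congˡ (pow-homo-* x m n)) (sym (*-assoc _ _ _))

  sgn*sgn≈1 : ∀ m → sgn m * sgn m ≈ 1#
  sgn*sgn≈1 zero    = *-identityˡ _
  sgn*sgn≈1 (suc m) = begin
    (- 1# * sgn m) * (- 1# * sgn m)  ≈⟨ solve 2 (λ o s → (o :* s) :* (o :* s) := (o :* o) :* (s :* s)) refl (- 1#) (sgn m) ⟩
    (- 1# * - 1#) * (sgn m * sgn m)  ≈⟨ *-cong (trans (-1*x≈-x (- 1#)) (⁻¹-involutive 1#)) (sgn*sgn≈1 m) ⟩
    1# * 1#                          ≈⟨ *-identityˡ _ ⟩
    1#                               ∎

  pow-neg : ∀ y m → pow (- y) m ≈ sgn m * pow y m
  pow-neg y zero    = sym (*-identityˡ _)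
  pow-neg y (suc m) = begin
    - y * pow (- y) m               ≈⟨ *-cong (sym (-1*x≈-x y)) (pow-neg y m) ⟩
    (- 1# * y) * (sgn m * pow y m)  ≈⟨ solve 4 (λ o y s p → (o :* y) :* (s :* p) := (o :* s) :* (y :* p)) refl (- 1#) y (sgn m) (pow y m) ⟩
    (- 1# * sgn m) * (y * pow y m)  ∎

  sumTo-cong : ∀ n {f g : ℕ → Carrier} → (∀ k → k ≤ n → f k ≈ g k) → sumTo n f ≈ sumTo n g
  sumTo-cong zero    f≈g = f≈g 0 z≤n
  sumTo-cong (suc n) f≈g = +-cong (sumTo-cong n (λ k k≤n → f≈g k (ℕₚ.m≤n⇒m≤1+n k≤n))) (f≈g (suc n) ℕₚ.≤-refl)

  sumTo-distrib-+ : ∀ n (f g : ℕ → Carrier) → sumTo n (λ k → f k + g k) ≈ sumTo n f + sumTo n g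
  sumTo-distrib-+ zero    f g = refl
  sumTo-distrib-+ (suc n) f g = trans (+-congʳ (sumTo-distrib-+ n f g))
    (solve 4 (λ a b c d → (a :+ b) :+ (c :+ d) := (a :+ c) :+ (b :+ d)) refl (sumTo n f) (sumTo n g) (f (suc n)) (g (suc n)))

  sumTo-*ˡ : ∀ n a (f : ℕ → Carrier) → sumTo n (λ k → a * f k) ≈ a * sumTo n f
  sumTo-*ˡ zero    a f = refl
  sumTo-*ˡ (suc n) a f = trans (+-congʳ (sumTo-*ˡ n a f)) (sym (distribˡ a (sumTo n f) (f (suc n))))

  sumTo-unfoldˡ : ∀ n (f : ℕ → Carrier) → sumTo (suc n) f ≈ f 0 + sumTo n (λ k → f (suc k))
  sumTo-unfoldˡ zero    f = refl
  sumTo-unfoldˡ (suc n) f = trans (+-congʳ (sumTo-unfoldˡ n f)) (+-assoc _ _ _)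

  -- Apoly α n x ≡ (α ⋆ pow x) n  and  Abi α r s x y ≡ (pow y ⋆ λ ν → Apoly α (s ℕ.+ ν) x) r.
  infixl 7 _⋆_
  _⋆_ : (ℕ → Carrier) → (ℕ → Carrier) → ℕ → Carrier
  (p ⋆ q) n = sumTo n (λ ν → fromℕ (n C ν) * (p (n ∸ ν) * q ν))

  shift : (ℕ → Carrier) → ℕ → Carrier
  shift p k = p (suc k)

  ⋆-congʳ : ∀ n p {q q′ : ℕ → Carrier} → (∀ k → q k ≈ q′ k) → (p ⋆ q) n ≈ (p ⋆ q′) n
  ⋆-congʳ n p q≈q′ = sumTo-cong n (λ k _ → *-congˡ (*-congˡ (q≈q′ k)))

  ⋆-zero : ∀ (p q : ℕ → Carrier) → (p ⋆ q) 0 ≈ p 0 * q 0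
  ⋆-zero p q = trans (*-congʳ (+-identityʳ 1#)) (*-identityˡ _)

  ⋆-*ˡ : ∀ n a (p q : ℕ → Carrier) → ((λ k → a * p k) ⋆ q) n ≈ a * (p ⋆ q) n
  ⋆-*ˡ n a p q = trans (sumTo-cong n (λ k _ → solve 4 (λ a C P Q → C :* ((a :* P) :* Q) := a :* (C :* (P :* Q))) refl
    a (fromℕ (n C k)) (p (n ∸ k)) (q k))) (sumTo-*ˡ n a _)

  ⋆-*ʳ : ∀ n a (p q : ℕ → Carrier) → (p ⋆ (λ k → a * q k)) n ≈ a * (p ⋆ q) n
  ⋆-*ʳ n a p q = trans (sumTo-cong n (λ k _ → solve 4 (λ a C P Q → C :* (P :* (a :* Q)) := a :* (C :* (P :* Q))) refl
    a (fromℕ (n C k)) (p (n ∸ k)) (q k))) (sumTo-*ˡ n a _)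

  ⋆-+ʳ : ∀ n (p q q′ : ℕ → Carrier) → (p ⋆ (λ k → q k + q′ k)) n ≈ (p ⋆ q) n + (p ⋆ q′) n
  ⋆-+ʳ n p q q′ = trans (sumTo-cong n (λ k _ → solve 4 (λ C P Q Q′ → C :* (P :* (Q :+ Q′)) := C :* (P :* Q) :+ C :* (P :* Q′)) refl
    (fromℕ (n C k)) (p (n ∸ k)) (q k) (q′ k))) (sumTo-distrib-+ n _ _)

  shift-⋆-unfold : ∀ n (p q : ℕ → Carrier) →
    fromℕ (suc n C 0) * (p (suc n) * q 0) + sumTo n (λ k → fromℕ (n C suc k) * (p (n ∸ k) * q (suc k)))
    ≈ (shift p ⋆ q) n
  shift-⋆-unfold zero    p q = trans (+-congˡ (zeroˡ _)) (+-identityʳ _)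
  shift-⋆-unfold (suc m) p q = begin
    t₀ + (sumTo m t + fromℕ (suc m C suc (suc m)) * (p (suc m ∸ suc m) * q (suc (suc m))))
      ≈⟨ +-congˡ (+-congˡ (trans (*-congʳ (reflexive (≡.cong fromℕ (k>n⇒nCk≡0 (ℕₚ.n<1+n (suc m)))))) (zeroˡ _))) ⟩
    t₀ + (sumTo m t + 0#)
      ≈⟨ +-congˡ (+-identityʳ _) ⟩
    t₀ + sumTo m t
      ≈⟨ +-congˡ (sumTo-cong m (λ k k≤m → *-congˡ (*-congʳ (reflexive (≡.cong p (ℕₚ.+-∸-assoc 1 k≤m)))))) ⟩
    t₀ + sumTo m (λ k → fromℕ (suc m C suc k) * (p (suc (m ∸ k)) * q (suc k)))
      ≈⟨ sumTo-unfoldˡ m _ ⟨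
    (shift p ⋆ q) (suc m) ∎
    where
    t₀ = fromℕ (suc (suc m) C 0) * (p (suc (suc m)) * q 0)
    t  = λ k → fromℕ (suc m C suc k) * (p (suc m ∸ k) * q (suc k))

  ⋆-suc : ∀ n (p q : ℕ → Carrier) → (p ⋆ q) (suc n) ≈ (shift p ⋆ q) n + (p ⋆ shift q) n
  ⋆-suc n p q = begin
    (p ⋆ q) (suc n)
      ≈⟨ sumTo-unfoldˡ n _ ⟩
    t₀ + sumTo n (λ k → fromℕ (suc n C suc k) * t k)
      ≈⟨ +-congˡ (sumTo-cong n (λ k _ → trans (*-congʳ pascal) (distribʳ (t k) _ _))) ⟩
    t₀ + sumTo n (λ k → fromℕ (n C k) * t k + fromℕ (n C suc k) * t k)
      ≈⟨ +-congˡ (sumTo-distrib-+ n _ _) ⟩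
    t₀ + ((p ⋆ shift q) n + rest)
      ≈⟨ solve 3 (λ a b c → a :+ (b :+ c) := (a :+ c) :+ b) refl t₀ _ rest ⟩
    (t₀ + rest) + (p ⋆ shift q) n
      ≈⟨ +-congʳ (shift-⋆-unfold n p q) ⟩
    (shift p ⋆ q) n + (p ⋆ shift q) n ∎
    where
    t₀   = fromℕ (suc n C 0) * (p (suc n) * q 0)
    t    = λ k → p (n ∸ k) * q (suc k)
    rest = sumTo n (λ k → fromℕ (n C suc k) * t k)
    pascal : ∀ {k} → fromℕ (suc n C suc k) ≈ fromℕ (n C k) + fromℕ (n C suc k)
    pascal {k} = trans (reflexive (≡.cong fromℕ (≡.sym (nCk+nC[k+1]≡[n+1]C[k+1] n k)))) (fromℕ-homo-+ (n C k) (n C suc k))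

  -- Stated for every coefficient sequence f because the induction step shifts f.
  appell-translation : ∀ x y n (f : ℕ → Carrier) → (pow y ⋆ (f ⋆ pow x)) n ≈ (f ⋆ pow (x + y)) n
  appell-translation x y zero f = begin
    (pow y ⋆ (f ⋆ pow x)) 0      ≈⟨ ⋆-zero (pow y) (f ⋆ pow x) ⟩
    1# * (f ⋆ pow x) 0           ≈⟨ *-identityˡ _ ⟩
    (f ⋆ pow x) 0                ≈⟨ ⋆-zero f (pow x) ⟩
    f 0 * 1#                     ≈⟨ ⋆-zero f (pow (x + y)) ⟨
    (f ⋆ pow (x + y)) 0          ∎
  appell-translation x y (suc n) f = begin
    (pow y ⋆ h) (suc n)
      ≈⟨ ⋆-suc n (pow y) h ⟩
    (shift (pow y) ⋆ h) n + (pow y ⋆ shift h) n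
      ≈⟨ +-cong (⋆-*ˡ n y (pow y) h) (⋆-congʳ n (pow y) shift-h) ⟩
    y * (pow y ⋆ h) n + (pow y ⋆ (λ k → x * h k + (shift f ⋆ pow x) k)) n
      ≈⟨ +-congˡ (trans (⋆-+ʳ n (pow y) _ _) (+-congʳ (⋆-*ʳ n x (pow y) h))) ⟩
    y * (pow y ⋆ h) n + (x * (pow y ⋆ h) n + (pow y ⋆ (shift f ⋆ pow x)) n)
      ≈⟨ +-cong (*-congˡ IH) (+-cong (*-congˡ IH) (appell-translation x y n (shift f))) ⟩
    y * w + (x * w + v)
      ≈⟨ solve 4 (λ x y w v → y :* w :+ (x :* w :+ v) := v :+ (x :+ y) :* w) refl x y w v ⟩
    v + (x + y) * w
      ≈⟨ +-congˡ (⋆-*ʳ n (x + y) f _) ⟨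
    (shift f ⋆ pow (x + y)) n + (f ⋆ shift (pow (x + y))) n
      ≈⟨ ⋆-suc n f (pow (x + y)) ⟨
    (f ⋆ pow (x + y)) (suc n) ∎
    where
    h  = f ⋆ pow x
    w  = (f ⋆ pow (x + y)) n
    v  = (shift f ⋆ pow (x + y)) n
    IH = appell-translation x y n f
    shift-h : ∀ k → shift h k ≈ x * h k + (shift f ⋆ pow x) k
    shift-h k = trans (⋆-suc k f (pow x)) (trans (+-congˡ (⋆-*ʳ k x f (pow x))) (+-comm _ _))

  pow-⋆-sgn : ∀ r y s (q : ℕ → Carrier) →
    (pow y ⋆ (λ k → sgn (r ℕ.+ k) * q k)) s ≈ sgn (r ℕ.+ s) * (pow (- y) ⋆ q) s
  pow-⋆-sgn r y s q = trans (sumTo-cong s term) (sumTo-*ˡ s _ _)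
    where
    term : ∀ ν → ν ≤ s → fromℕ (s C ν) * (pow y (s ∸ ν) * (sgn (r ℕ.+ ν) * q ν))
                         ≈ sgn (r ℕ.+ s) * (fromℕ (s C ν) * (pow (- y) (s ∸ ν) * q ν))
    term ν ν≤s = sym (begin
      sgn (r ℕ.+ s) * (b * (pow (- y) m * q ν))
        ≈⟨ *-cong (reflexive (≡.cong sgn r+s≡r+ν+m)) (*-congˡ (*-congʳ (pow-neg y m))) ⟩
      sgn ((r ℕ.+ ν) ℕ.+ m) * (b * ((sgn m * pow y m) * q ν))
        ≈⟨ *-congʳ (pow-homo-* (- 1#) (r ℕ.+ ν) m) ⟩
      (σ * sgn m) * (b * ((sgn m * pow y m) * q ν))
        ≈⟨ solve 5 (λ S M B Y Q → (S :* M) :* (B :* ((M :* Y) :* Q)) := (M :* M) :* (B :* (Y :* (S :* Q)))) refl σ (sgn m) b (pow y m) (q ν) ⟩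
      (sgn m * sgn m) * (b * (pow y m * (σ * q ν)))
        ≈⟨ trans (*-congʳ (sgn*sgn≈1 m)) (*-identityˡ _) ⟩
      b * (pow y m * (σ * q ν)) ∎)
      where
      m = s ∸ ν
      b = fromℕ (s C ν)
      σ = sgn (r ℕ.+ ν)
      r+s≡r+ν+m : r ℕ.+ s ≡.≡ (r ℕ.+ ν) ℕ.+ m
      r+s≡r+ν+m = ≡.trans (≡.cong (r ℕ.+_) (≡.sym (ℕₚ.m+[n∸m]≡n ν≤s))) (≡.sym (ℕₚ.+-assoc r ν m))

  module _ (α : ℕ → Carrier) where

    Apoly-cong : ∀ n {x x′} → x ≈ x′ → Apoly α n x ≈ Apoly α n x′
    Apoly-cong n x≈x′ = ⋆-congʳ n α (λ k → pow-cong k x≈x′)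

    Abi-zero : ∀ s x y → Abi α 0 s x y ≈ Apoly α s x
    Abi-zero s x y = begin
      Abi α 0 s x y            ≈⟨ ⋆-zero (pow y) (λ k → Apoly α (s ℕ.+ k) x) ⟩
      1# * Apoly α (s ℕ.+ 0) x  ≈⟨ *-identityˡ _ ⟩
      Apoly α (s ℕ.+ 0) x       ≡⟨ ≡.cong (λ m → Apoly α m x) (ℕₚ.+-identityʳ s) ⟩
      Apoly α s x               ∎

    Abi-suc : ∀ r s x y → Abi α (suc r) s x y ≈ y * Abi α r s x y + Abi α r (suc s) x y
    Abi-suc r s x y = trans (⋆-suc r (pow y) (λ k → Apoly α (s ℕ.+ k) x))
      (+-cong (⋆-*ˡ r y (pow y) _) (⋆-congʳ r (pow y) (λ k → reflexive (≡.cong (λ m → Apoly α m x) (ℕₚ.+-suc s k)))))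

    Abi-swap : ∀ r s x y → Abi α r s x y ≈ Abi α s r (x + y) (- y)
    Abi-swap zero s x y = begin
      Abi α 0 s x y                          ≈⟨ Abi-zero s x y ⟩
      Apoly α s x                            ≈⟨ Apoly-cong s x+y-y≈x ⟨
      Apoly α s ((x + y) + - y)              ≈⟨ appell-translation (x + y) (- y) s α ⟨
      (pow (- y) ⋆ (α ⋆ pow (x + y))) s      ≡⟨⟩
      Abi α s 0 (x + y) (- y)                ∎
      where
      x+y-y≈x : (x + y) + - y ≈ x
      x+y-y≈x = trans (+-assoc x y (- y)) (trans (+-congˡ (-‿inverseʳ y)) (+-identityʳ x))
    Abi-swap (suc r) s x y = begin
      Abi α (suc r) s x y                      ≈⟨ Abi-suc r s x y ⟩
      y * Abi α r s x y + Abi α r (suc s) x y  ≈⟨ +-cong (*-congˡ (Abi-swap r s x y)) (Abi-swap r (suc s) x y) ⟩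
      y * b + Abi α (suc s) r (x + y) (- y)    ≈⟨ +-congˡ (Abi-suc s r (x + y) (- y)) ⟩
      y * b + (- y * b + e)                    ≈⟨ +-assoc _ _ _ ⟨
      (y * b + - y * b) + e                    ≈⟨ +-congʳ (distribʳ b y (- y)) ⟨
      (y + - y) * b + e                        ≈⟨ +-congʳ (trans (*-congʳ (-‿inverseʳ y)) (zeroˡ b)) ⟩
      0# + e                                   ≈⟨ +-identityˡ e ⟩
      e                                        ∎
      where
      b = Abi α s r (x + y) (- y)
      e = Abi α s (suc r) (x + y) (- y)

    Abi-reflect : (∀ m x → Apoly α m (1# - x) ≈ sgn m * Apoly α m x) →
                  ∀ r s x y → sgn r * Abi α r s x y ≈ sgn s * Abi α s r ((1# - x) - y) y
    Abi-reflect reflect r s x y = sym (begin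
      sgn s * Abi α s r ((1# - x) - y) y
        ≈⟨ *-congˡ (⋆-congʳ s (pow y) (λ k → trans (Apoly-cong (r ℕ.+ k) 1-x-y≈1-[x+y]) (reflect (r ℕ.+ k) (x + y)))) ⟩
      sgn s * (pow y ⋆ (λ k → sgn (r ℕ.+ k) * Apoly α (r ℕ.+ k) (x + y))) s
        ≈⟨ *-congˡ (pow-⋆-sgn r y s _) ⟩
      sgn s * (sgn (r ℕ.+ s) * Abi α s r (x + y) (- y))
        ≈⟨ *-congˡ (*-cong (pow-homo-* (- 1#) r s) (sym (Abi-swap r s x y))) ⟩
      sgn s * ((sgn r * sgn s) * a)
        ≈⟨ solve 3 (λ S R A → S :* ((R :* S) :* A) := (S :* S) :* (R :* A)) refl (sgn s) (sgn r) a ⟩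
      (sgn s * sgn s) * (sgn r * a)
        ≈⟨ trans (*-congʳ (sgn*sgn≈1 s)) (*-identityˡ _) ⟩
      sgn r * a ∎)
      where
      a = Abi α r s x y
      1-x-y≈1-[x+y] : (1# - x) - y ≈ 1# - (x + y)
      1-x-y≈1-[x+y] = trans (+-assoc 1# (- x) (- y)) (+-congˡ (⁻¹-∙-comm x y))

theorem3p5 : ∀ {c ℓ : Level} (R : CommutativeRing c ℓ) (α : ℕ → CommutativeRing.Carrier R) →
    (∀ (r s : ℕ) (x y : CommutativeRing.Carrier R) →
      CommutativeRing._≈_ R (Ops.Abi R α r s x y)
        (Ops.Abi R α s r (CommutativeRing._+_ R x y) (CommutativeRing.-_ R y)))
    × ((∀ (m : ℕ) (x : CommutativeRing.Carrier R) →
         CommutativeRing._≈_ R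
           (Ops.Apoly R α m (CommutativeRing._-_ R (CommutativeRing.1# R) x))
           (CommutativeRing._*_ R (Ops.sgn R m) (Ops.Apoly R α m x)))
      → ∀ (r s : ℕ) (x y : CommutativeRing.Carrier R) →
        CommutativeRing._≈_ R
          (CommutativeRing._*_ R (Ops.sgn R r) (Ops.Abi R α r s x y))
          (CommutativeRing._*_ R (Ops.sgn R s)
            (Ops.Abi R α s r (CommutativeRing._-_ R (CommutativeRing._-_ R (CommutativeRing.1# R) x) y) y)))
theorem3p5 R α = Abi-swap α , Abi-reflect α
  where open BinomialConvolution R
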